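{- Let $m\geq 1$, $h\geq m$ and $s,d,l\geq 1$ be integers with $\max\{d,m\}\geq 2$. Then there exists an integer $t\leq\left\lfloor\frac{s+4h}{m+1}\right\rfloor$ such that \[ |\mathcal{D}_m(s,l,h,d)|\leq|\mathcal{D}_m(t(m+1),0,h,d)|. \]
   Context: For an integer $m\geq1$, a partial $m$-Dyck path is a lattice path in the upper half-plane $\{y\geq 0\}$ starting at $(0,0)$ using steps $(1,1)$ (rises) and $(1,-m)$ ($m$-falls). The level of a point is its $y$-coordinate; the height of the path is the maximum level reached; the length is the number of steps. A full $m$-Dyck path is one ending at level $0$. The maximum descent of a path is the length of a longest run of consecutive $m$-falls. For integers $s,l,h,d\geq0$, $\mathcal{D}_m(s,l,h,d)$ denotes the set of partial $m$-Dyck paths ending at $(s,l)$, with height at most $h$ and maximum descent at most $d$. -}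

module Defs where

open import Data.Nat using (ℕ; zero; suc; _+_; _*_; _∸_; _≤ᵇ_; _≡ᵇ_)
open import Data.Nat.Properties
open import Data.Bool using (Bool; true; false; _∧_; if_then_else_)
open import Data.List using (List; []; _∷_; map; _++_; length; filterᵇ)

-- A step of an m-Dyck path: a rise (1,1) or an m-fall (1,-m).
data Step : Set where
  rise fall : Step

allWords : ℕ → List (List Step)
allWords zero    = [] ∷ []
allWords (suc n) = map (rise ∷_) (allWords n) ++ map (fall ∷_) (allWords n)

check : (m h d l : ℕ) → (lvl run : ℕ) → List Step → Bool
check m h d l lvl run []           = lvl ≡ᵇ l
check m h d l lvl run (rise ∷ w)   = (suc lvl ≤ᵇ h) ∧ check m h d l (suc lvl) 0 w
check m h d l lvl run (fall ∷ w)   = (m ≤ᵇ lvl) ∧ (suc run ≤ᵇ d) ∧ check m h d l (lvl ∸ m) (suc run) w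

-- The set D_m(s,l,h,d): partial m-Dyck paths ending at (s,l), of height at
-- most h and maximum descent at most d (paths start at (0,0), level 0 ≤ h
-- is needed for the starting point to be admissible).
Dset : (m s l h d : ℕ) → List (List Step)
Dset m s l h d = filterᵇ (check m h d l 0 0) (allWords s)

card : (m s l h d : ℕ) → ℕ
card m s l h d = length (Dset m s l h d)

-- Fix a path u of length at most 4h that leads from level l back to level 0
-- and may follow any run of falls that a path can have at level l.  Appending
-- u maps D_m(s,l,h,d) injectively into the full paths of length s + |u|, and
-- the length of a full path is a multiple of m + 1 because every m-fall undoes
-- m rises; so s + |u| = t(m + 1) with t ≤ (s + 4h)/(m + 1).
module Submission where

open import Defs
open import Data.Nat using (ℕ; zero; suc; _+_; _*_; _∸_; _⊔_; _≤_; _<_; _≤?_; z≤n; s≤s; NonZero)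
open import Data.Nat.Properties
open import Data.Nat.DivMod using (_/_; m*n/n≡m; /-monoˡ-≤)
open import Data.Nat.Induction using (<-rec)
open import Data.Bool using (T)
open import Data.Bool.Properties using (T-∧)
open import Data.Product using (∃-syntax; _×_; _,_)
open import Data.Sum using (_⊎_; inj₁; inj₂)
open import Data.List using (List; []; _∷_; map; _++_; length; filter; replicate)
open import Data.List.Properties using (length-map; length-++; length-replicate; map-++; map-∘; filter-all)
open import Data.List.Membership.Propositional using (_∈_)
open import Data.List.Membership.Propositional.Properties
  using (∈-map⁺; ∈-map⁻; ∈-++⁺ˡ; ∈-++⁺ʳ; ∈-++⁻; ∈-filter⁻)
open import Data.List.Relation.Unary.Any using (here)
import Data.List.Relation.Unary.All as All
open import Data.List.Relation.Unary.All.Properties using (all-filter) renaming (map⁺ to All-map⁺)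
open import Data.List.Relation.Binary.Sublist.Propositional using (_⊆_; ⊆-trans; from∈)
open import Data.List.Relation.Binary.Sublist.Propositional.Properties
  using (map⁺; ++⁺; filter⁺; filter-⊆; length-mono-≤)
open import Function using (_∘_; Equivalence)
open import Level using (0ℓ)
open import Relation.Nullary using (yes; no; contradiction)
open import Relation.Nullary.Decidable using (T?)
open import Relation.Unary using (Pred; Decidable)
open import Relation.Binary.PropositionalEquality

private
  variable
    m h d l l′ x lvl run : ℕ
    u v w : List Step

data Path (m h d l : ℕ) : ℕ → ℕ → List Step → Set where
  done : Path m h d l l run []
  up   : suc lvl ≤ h → Path m h d l (suc lvl) 0 w → Path m h d l lvl run (rise ∷ w)
  down : m ≤ lvl → suc run ≤ d → Path m h d l (lvl ∸ m) (suc run) w →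
         Path m h d l lvl run (fall ∷ w)

check⇒Path : T (check m h d l lvl run w) → Path m h d l lvl run w
check⇒Path {l = l} {lvl = lvl} {w = []} t =
  subst (λ z → Path _ _ _ l z _ []) (sym (≡ᵇ⇒≡ lvl l t)) done
check⇒Path {h = h} {lvl = lvl} {w = rise ∷ w} t
  with lvl<h , rest ← Equivalence.to T-∧ t = up (≤ᵇ⇒≤ (suc lvl) h lvl<h) (check⇒Path rest)
check⇒Path {m = m} {d = d} {lvl = lvl} {run = run} {w = fall ∷ w} t
  with m≤lvl , t′ ← Equivalence.to T-∧ t
  with run<d , rest ← Equivalence.to T-∧ t′ =
  down (≤ᵇ⇒≤ m lvl m≤lvl) (≤ᵇ⇒≤ (suc run) d run<d) (check⇒Path rest)

Path⇒check : Path m h d l lvl run w → T (check m h d l lvl run w)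
Path⇒check {l = l} done       = ≡⇒≡ᵇ l l refl
Path⇒check (up lvl<h π)       = Equivalence.from T-∧ (≤⇒≤ᵇ lvl<h , Path⇒check π)
Path⇒check (down m≤lvl run<d π) =
  Equivalence.from T-∧ (≤⇒≤ᵇ m≤lvl , Equivalence.from T-∧ (≤⇒≤ᵇ run<d , Path⇒check π))

Path-end≤ : lvl ≤ h → Path m h d l lvl run w → l ≤ h
Path-end≤ lvl≤h done             = lvl≤h
Path-end≤ lvl≤h (up lvl<h π)     = Path-end≤ lvl<h π
Path-end≤ {lvl = lvl} {m = m} lvl≤h (down _ _ π) = Path-end≤ (≤-trans (m∸n≤m lvl m) lvl≤h) π

Path-length-mod : Path m h d l lvl run w → ∃[ F ] lvl + length w ≡ l + F * suc m
Path-length-mod done = 0 , refl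
Path-length-mod {lvl = lvl} {w = rise ∷ w} (up _ π)
  with F , eq ← Path-length-mod π = F , trans (+-suc lvl (length w)) eq
Path-length-mod {m = m} {l = l} {lvl = lvl} {w = fall ∷ w} (down m≤lvl _ π)
  with F , eq ← Path-length-mod π = suc F , (begin
    lvl + suc n                     ≡⟨ cong (_+ suc n) (sym (m∸n+n≡m m≤lvl)) ⟩
    (lvl ∸ m + m) + suc n           ≡⟨ shuffle (lvl ∸ m) ⟩
    (lvl ∸ m + n) + suc m           ≡⟨ cong (_+ suc m) eq ⟩
    (l + F * suc m) + suc m         ≡⟨ +-assoc l _ _ ⟩
    l + (F * suc m + suc m)         ≡⟨ cong (l +_) (+-comm (F * suc m) (suc m)) ⟩
    l + suc F * suc m               ∎)
  where
  open ≡-Reasoning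
  n = length w
  shuffle : ∀ a → (a + m) + suc n ≡ (a + n) + suc m
  shuffle a = begin
    (a + m) + suc n   ≡⟨ +-assoc a m (suc n) ⟩
    a + (m + suc n)   ≡⟨ cong (a +_) (trans (+-suc m n) (cong suc (+-comm m n))) ⟩
    a + suc (n + m)   ≡⟨ cong (a +_) (sym (+-suc n m)) ⟩
    a + (n + suc m)   ≡⟨ +-assoc a n (suc m) ⟨
    (a + n) + suc m   ∎

-- A positive run of falls ending at lvl must have come down from level m + lvl.
Admissible : ℕ → ℕ → ℕ → ℕ → Set
Admissible m h lvl run = run ≡ 0 ⊎ m + lvl ≤ h

Path-++ : lvl ≤ h → Admissible m h lvl run → Path m h d l lvl run w →
          (∀ {r} → Admissible m h l r → Path m h d l′ l r u) →
          Path m h d l′ lvl run (w ++ u)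
Path-++ _     adm done                 return = return adm
Path-++ _     _   (up lvl<h π)         return = up lvl<h (Path-++ lvl<h (inj₁ refl) π return)
Path-++ {lvl = lvl} {m = m} lvl≤h _ (down m≤lvl run<d π) return =
  down m≤lvl run<d
    (Path-++ (≤-trans (m∸n≤m lvl m) lvl≤h) (inj₂ (subst (_≤ _) (sym (m+[n∸m]≡n m≤lvl)) lvl≤h))
             π return)

rises : ∀ j → j + x ≤ h → Path m h d l (j + x) 0 w → Path m h d l x 0 (replicate j rise ++ w)
rises zero    _     π = π
rises {x = x} {h = h} {m = m} {d = d} {l = l} {w = w} (suc j) j+x<h π =
  up (≤-trans (s≤s (m≤n+m x j)) j+x<h)
     (rises j (subst (_≤ h) (sym (+-suc j x)) j+x<h)
              (subst (λ z → Path m h d l z 0 w) (sym (+-suc j x)) π))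

climb-and-fall : x ≤ m → m ≤ h → 1 ≤ d → Path m h d 0 x 0 (replicate (m ∸ x) rise ++ fall ∷ [])
climb-and-fall {x = x} {m = m} {h = h} {d = d} x≤m m≤h 1≤d =
  rises (m ∸ x) (subst (_≤ h) (sym (m∸n+n≡m x≤m)) m≤h)
        (subst (λ z → Path m h d 0 z 0 (fall ∷ [])) (sym (m∸n+n≡m x≤m)) fall-to-ground)
  where
  fall-to-ground : Path m h d 0 m 0 (fall ∷ [])
  fall-to-ground = down ≤-refl 1≤d (subst (λ z → Path m h d 0 z 1 []) (sym (n∸n≡0 m)) done)

-- For m = 1 a fall-fall-rise block lowers the level by one.
descent-unit : 2 ≤ d → 1 ≤ x → x ≤ h → ∃[ u ] Path 1 h d 0 x 0 u × length u ≤ 3 * x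
descent-unit {x = suc zero} 2≤d _ _ = fall ∷ [] , down (s≤s z≤n) (≤-trans (s≤s z≤n) 2≤d) done , s≤s z≤n
descent-unit {x = suc (suc y)} 2≤d _ x≤h
  with u , π , bound ← descent-unit 2≤d (s≤s z≤n) (≤-trans (n≤1+n _) x≤h) =
  fall ∷ fall ∷ rise ∷ u ,
  down (s≤s z≤n) (≤-trans (s≤s z≤n) 2≤d) (down (s≤s z≤n) 2≤d (up (≤-trans (n≤1+n _) x≤h) π)) ,
  ≤-trans (s≤s (s≤s (s≤s bound))) (≤-reflexive (sym (*-suc 3 (suc y))))

-- For m ≥ 2 a fall-rise block lowers the level by m - 1; close to the ground
-- one climbs to level m and falls once.
descent-steep : 2 ≤ m → m ≤ h → 1 ≤ d → ∀ x → 1 ≤ x → x ≤ h →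
                ∃[ u ] Path m h d 0 x 0 u × length u ≤ 2 * x + h
descent-steep {m = m} {h = h} {d = d} 2≤m m≤h 1≤d = <-rec P step
  where
  P : ℕ → Set
  P x = 1 ≤ x → x ≤ h → ∃[ u ] Path m h d 0 x 0 u × length u ≤ 2 * x + h

  step : ∀ x → (∀ {y} → y < x → P y) → P x
  step x rec 1≤x x≤h with x ≤? m
  ... | yes x≤m = replicate (m ∸ x) rise ++ fall ∷ [] , climb-and-fall x≤m m≤h 1≤d , bound
    where
    bound : length (replicate (m ∸ x) rise ++ fall ∷ []) ≤ 2 * x + h
    bound = begin
      length (replicate (m ∸ x) rise ++ fall ∷ []) ≡⟨ length-++ (replicate (m ∸ x) rise) ⟩
      length (replicate (m ∸ x) rise) + 1          ≡⟨ cong (_+ 1) (length-replicate (m ∸ x)) ⟩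
      m ∸ x + 1                                    ≤⟨ +-monoʳ-≤ (m ∸ x) 1≤x ⟩
      m ∸ x + x                                    ≡⟨ m∸n+n≡m x≤m ⟩
      m                                            ≤⟨ ≤-trans m≤h (m≤n+m h (2 * x)) ⟩
      2 * x + h                                    ∎
      where open ≤-Reasoning
  ... | no x≰m =
    let u , π , bound = rec y<x (s≤s z≤n) y≤h in
    fall ∷ rise ∷ u , down m≤x 1≤d (up y≤h π) ,
    ≤-trans (s≤s (s≤s bound))
      (≤-trans (≤-reflexive (cong (_+ h) (sym (*-suc 2 y)))) (+-monoˡ-≤ h (*-monoʳ-≤ 2 y<x)))
    where
    m≤x = <⇒≤ (≰⇒> x≰m)
    y = suc (x ∸ m)
    y<x : suc y ≤ x
    y<x = ≤-trans (+-monoˡ-≤ (x ∸ m) 2≤m) (≤-reflexive (m+[n∸m]≡n m≤x))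
    y≤h : y ≤ h
    y≤h = ≤-trans (n≤1+n y) (≤-trans y<x x≤h)

descent : 1 ≤ m → m ≤ h → 1 ≤ d → 2 ≤ d ⊔ m → 1 ≤ x → x ≤ h →
          ∃[ u ] Path m h d 0 x 0 u × length u ≤ 3 * h
descent {m = suc zero} _ _ 1≤d 2≤d⊔m 1≤x x≤h
  with u , π , bound ← descent-unit (subst (2 ≤_) (m≥n⇒m⊔n≡m 1≤d) 2≤d⊔m) 1≤x x≤h =
  u , π , ≤-trans bound (*-monoʳ-≤ 3 x≤h)
descent {m = suc (suc _)} {h = h} {x = x} _ m≤h 1≤d _ 1≤x x≤h
  with u , π , bound ← descent-steep (s≤s (s≤s z≤n)) m≤h 1≤d x 1≤x x≤h =
  u , π , ≤-trans bound (≤-trans (+-monoˡ-≤ h (*-monoʳ-≤ 2 x≤h)) (≤-reflexive (+-comm (2 * h) h)))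

return-path : 1 ≤ m → m ≤ h → 1 ≤ d → 2 ≤ d ⊔ m → l ≤ h →
              ∃[ u ] (∀ {r} → Admissible m h l r → Path m h d 0 l r u) × length u ≤ 4 * h
return-path {m = m} {h = h} {d = d} {l = l} 1≤m m≤h 1≤d 2≤d⊔m l≤h with suc l ≤? h
... | yes l<h with u , π , bound ← descent 1≤m m≤h 1≤d 2≤d⊔m (s≤s z≤n) l<h =
  rise ∷ u , (λ _ → up l<h π) , ≤-trans (s≤s bound) (+-monoˡ-≤ (3 * h) (≤-trans 1≤m m≤h))
... | no l≮h =
  let u , π , bound = descent 1≤m m≤h 1≤d 2≤d⊔m 1≤l l≤h in
  u , from-top π , ≤-trans bound (m≤n+m (3 * h) h)
  where
  1≤l : 1 ≤ l
  1≤l = ≤-trans 1≤m (≤-trans m≤h (≮⇒≥ l≮h))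
  from-top : Path m h d 0 l 0 u → ∀ {r} → Admissible m h l r → Path m h d 0 l r u
  from-top π (inj₁ refl)    = π
  from-top π (inj₂ m+l≤h) = contradiction (≤-trans (+-monoˡ-≤ l 1≤m) m+l≤h) l≮h

∈-allWords : ∀ w → w ∈ allWords (length w)
∈-allWords []         = here refl
∈-allWords (rise ∷ w) = ∈-++⁺ˡ (∈-map⁺ (rise ∷_) (∈-allWords w))
∈-allWords (fall ∷ w) = ∈-++⁺ʳ (map (rise ∷_) (allWords (length w))) (∈-map⁺ (fall ∷_) (∈-allWords w))

allWords-length : ∀ {n} → w ∈ allWords n → length w ≡ n
allWords-length {n = zero} (here refl) = refl
allWords-length {n = suc n} w∈ with ∈-++⁻ (map (rise ∷_) (allWords n)) w∈
... | inj₁ w∈rises with _ , w′∈ , refl ← ∈-map⁻ (rise ∷_) w∈rises = cong suc (allWords-length w′∈)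
... | inj₂ w∈falls with _ , w′∈ , refl ← ∈-map⁻ (fall ∷_) w∈falls = cong suc (allWords-length w′∈)

-- allWords n lists the words in lexicographic order, which appending v preserves.
allWords-++ : ∀ n v → map (_++ v) (allWords n) ⊆ allWords (n + length v)
allWords-++ zero    v = from∈ (∈-allWords v)
allWords-++ (suc n) v =
  subst (_⊆ allWords (suc n + length v)) (sym split)
        (++⁺ (map⁺ (rise ∷_) (allWords-++ n v)) (map⁺ (fall ∷_) (allWords-++ n v)))
  where
  ws = allWords n
  prepend-commutes : ∀ s → map (_++ v) (map (s ∷_) ws) ≡ map (s ∷_) (map (_++ v) ws)
  prepend-commutes s = trans (sym (map-∘ {g = _++ v} {f = s ∷_} ws)) (map-∘ {g = s ∷_} {f = _++ v} ws)
  split : map (_++ v) (allWords (suc n)) ≡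
          map (rise ∷_) (map (_++ v) ws) ++ map (fall ∷_) (map (_++ v) ws)
  split = trans (map-++ (_++ v) (map (rise ∷_) ws) (map (fall ∷_) ws))
                (cong₂ _++_ (prepend-commutes rise) (prepend-commutes fall))

length-filter-map-≤ : ∀ {A B : Set} {P : Pred A 0ℓ} {Q : Pred B 0ℓ} (P? : Decidable P) (Q? : Decidable Q)
                      (f : A → B) {xs ys} → (∀ {x} → P x → Q (f x)) → map f xs ⊆ ys →
                      length (filter P? xs) ≤ length (filter Q? ys)
length-filter-map-≤ P? Q? f {xs} {ys} P⇒Q∘f fxs⊆ys = begin
  length (filter P? xs)                     ≡⟨ length-map f (filter P? xs) ⟨
  length (map f (filter P? xs))             ≡⟨ cong length (filter-all Q? images-pass) ⟨
  length (filter Q? (map f (filter P? xs))) ≤⟨ length-mono-≤ (filter⁺ Q? Q? (λ { refl q → q }) images⊆ys) ⟩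
  length (filter Q? ys)                     ∎
  where
  open ≤-Reasoning
  images-pass = All-map⁺ (All.map P⇒Q∘f (all-filter P? xs))
  images⊆ys = ⊆-trans (map⁺ f (filter-⊆ P? xs)) fxs⊆ys

card-++ : ∀ s → (∀ {r} → Admissible m h l r → Path m h d 0 l r u) →
          card m s l h d ≤ card m (s + length u) 0 h d
card-++ {m = m} {h = h} {l = l} {d = d} {u = u} s return =
  length-filter-map-≤ (T? ∘ check m h d l 0 0) (T? ∘ check m h d 0 0 0) (_++ u)
    (λ {w} valid → Path⇒check (Path-++ z≤n (inj₁ refl) (check⇒Path {w = w} valid) return))
    (allWords-++ s u)

∈-Dset : ∀ {s} → w ∈ Dset m s l h d → Path m h d l 0 0 w × length w ≡ s
∈-Dset {m = m} {l = l} {h = h} {d = d} w∈ =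
  let w∈allWords , valid = ∈-filter⁻ (T? ∘ check m h d l 0 0) w∈ in
  check⇒Path valid , allWords-length w∈allWords

m*n≤o⇒m≤o/n : ∀ {m o} n .{{_ : NonZero n}} → m * n ≤ o → m ≤ o / n
m*n≤o⇒m≤o/n {m = m} n m*n≤o = subst (_≤ _) (m*n/n≡m m n) (/-monoˡ-≤ n m*n≤o)

lemma7 : (m h s d l : ℕ) → 1 ≤ m → m ≤ h → 1 ≤ s → 1 ≤ d → 1 ≤ l → 2 ≤ d ⊔ m →
    ∃[ t ] (t ≤ (s + 4 * h) / suc m) × (card m s l h d ≤ card m (t * suc m) 0 h d)
lemma7 m h s d l 1≤m m≤h _ 1≤d _ 2≤d⊔m with Dset m s l h d in eq
... | [] = 0 , z≤n , z≤n
... | w ∷ _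
  with π , |w|≡s ← ∈-Dset (subst (w ∈_) (sym eq) (here refl))
  with u′ , return , |u′|≤4h ← return-path 1≤m m≤h 1≤d 2≤d⊔m (Path-end≤ z≤n π)
  with t , full-length ← Path-length-mod (Path-++ z≤n (inj₁ refl) π return) =
  t , m*n≤o⇒m≤o/n (suc m) (subst (_≤ s + 4 * h) s+|u′|≡ (+-monoʳ-≤ s |u′|≤4h)) ,
  subst₂ (λ c n → c ≤ card m n 0 h d) (cong length eq) s+|u′|≡ (card-++ s return)
  where
  s+|u′|≡ : s + length u′ ≡ t * suc m
  s+|u′|≡ = trans (cong (_+ length u′) (sym |w|≡s)) (trans (sym (length-++ w)) full-length)
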